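{- During the execution of Algorithm Pack\_Disks (described in the context), let $S$ and $L$ be the sums of the $s$- and $l$-weights of the items currently in the open bin, and let $lp$ be the index of the first unassigned l-heavy item. If $S\ge L$ and $S+s_{lp}>1$, then $S-L\le s_{t}-l_{t}$, where $t$ is the index of the last s-heavy item added to the current bin.
   Context: Items $(s_1,l_1),\dots,(s_n,l_n)$ with $s_i,l_i\in[0,1]$; bins have capacity $1$ in each coordinate; $\rho=\max_i\{s_i,l_i\}$. An item is s-heavy if $s_i\ge l_i$ and l-heavy otherwise. Algorithm Pack\_Disks: a bin is opened with the first unassigned item. While there remain both unassigned s-heavy and unassigned l-heavy items: if the current bin's sums satisfy $S\ge L$, the first unassigned l-heavy item is added to the bin, and if this makes $S>1$ the most recently added s-heavy item of the bin is removed; if $L>S$, the first unassigned s-heavy item is added, and if this makes $L>1$ the most recently added l-heavy item of the bin is removed. After each such step, if $S\ge1-\rho$ and $L\ge 1-\rho$ the bin is closed and a new bin is opened with the next unassigned item. (Thus, within a bin, an s-heavy item is added only when $L>S$ and an l-heavy item only when $S\ge L$, apart from the first item of the bin.)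
   Formalization: The item weights $s_i$ and $l_i$ are rational numbers in [0,1]. -}

module Defs where

open import Data.Nat using (ℕ)
open import Data.Fin using (Fin; _≟_)
open import Data.Bool using (Bool; true; false; if_then_else_)
open import Data.Maybe using (Maybe; just; nothing)
open import Data.Product using (_×_; _,_)
open import Data.List using (List; []; _∷_; foldr; map; filter; filterᵇ; head; allFin)
open import Data.Rational using (ℚ; 0ℚ; 1ℚ; _+_; _-_; _⊔_; _≤_; _<_)
open import Data.Rational.Properties using (_≤?_; _<?_)
open import Relation.Nullary using (¬_; ¬?; yes; no; does)
open import Relation.Binary.PropositionalEquality using (_≡_)

-- The algorithm Pack_Disks, for items (s i , l i), i : Fin n.
-- Item indices are ordered by Fin order ("first" = smallest index).
module PackDisks {n : ℕ} (s l : Fin n → ℚ) where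

  SHeavy : Fin n → Set
  SHeavy i = l i ≤ s i

  sHeavy? : (i : Fin n) → _
  sHeavy? i = l i ≤? s i

  LHeavy : Fin n → Set
  LHeavy i = ¬ SHeavy i

  lHeavy? : (i : Fin n) → _
  lHeavy? i = ¬? (sHeavy? i)

  ρ : ℚ
  ρ = foldr _⊔_ 0ℚ (map (λ i → s i ⊔ l i) (allFin n))

  -- State of the loop: the items of the currently open bin, listed
  -- most-recently-added FIRST, and the set of unassigned items.
  record State : Set where
    constructor ⟨_,_⟩
    field
      bin : List (Fin n)
      un  : Fin n → Bool
  open State public

  Ssum : List (Fin n) → ℚ
  Ssum = foldr (λ i acc → s i + acc) 0ℚ

  Lsum : List (Fin n) → ℚ
  Lsum = foldr (λ i acc → l i + acc) 0ℚ

  setUn : (Fin n → Bool) → Fin n → Bool → (Fin n → Bool)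
  setUn u i b j = if does (j ≟ i) then b else u j

  unList : (Fin n → Bool) → List (Fin n)
  unList u = filterᵇ u (allFin n)

  firstS : State → Maybe (Fin n)
  firstS st = head (filter sHeavy? (unList (un st)))

  firstL : State → Maybe (Fin n)
  firstL st = head (filter lHeavy? (unList (un st)))

  lastS : List (Fin n) → Maybe (Fin n)
  lastS b = head (filter sHeavy? b)

  removeLast : ∀ {P : Fin n → Set} → (∀ i → Relation.Nullary.Dec (P i)) →
               List (Fin n) → Maybe (Fin n × List (Fin n))
  removeLast P? [] = nothing
  removeLast P? (x ∷ xs) with P? x
  ... | yes _ = just (x , xs)
  ... | no _ with removeLast P? xs
  ...   | nothing = nothing
  ...   | just (y , ys) = just (y , x ∷ ys)

  openBin : (Fin n → Bool) → State
  openBin u with head (unList u)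
  ... | nothing = ⟨ [] , u ⟩
  ... | just i  = ⟨ i ∷ [] , setUn u i false ⟩

  initial : State
  initial = openBin (λ _ → true)

  addL : State → Fin n → State
  addL st j with 1ℚ <? Ssum (j ∷ bin st)
  ... | no _ = ⟨ j ∷ bin st , setUn (un st) j false ⟩
  ... | yes _ with removeLast sHeavy? (j ∷ bin st)
  ...   | nothing = ⟨ j ∷ bin st , setUn (un st) j false ⟩
  ...   | just (r , b') = ⟨ b' , setUn (setUn (un st) j false) r true ⟩

  addS : State → Fin n → State
  addS st k with 1ℚ <? Lsum (k ∷ bin st)
  ... | no _ = ⟨ k ∷ bin st , setUn (un st) k false ⟩
  ... | yes _ with removeLast lHeavy? (k ∷ bin st)
  ...   | nothing = ⟨ k ∷ bin st , setUn (un st) k false ⟩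
  ...   | just (r , b') = ⟨ b' , setUn (setUn (un st) k false) r true ⟩

  closeCheck : State → State
  closeCheck st with 1ℚ - ρ ≤? Ssum (bin st) | 1ℚ - ρ ≤? Lsum (bin st)
  ... | yes _ | yes _ = openBin (un st)
  ... | _     | _     = st

  data Step : State → State → Set where
    stepL : ∀ {st j k} → firstL st ≡ just j → firstS st ≡ just k →
            Lsum (bin st) ≤ Ssum (bin st) → Step st (closeCheck (addL st j))
    stepS : ∀ {st j k} → firstL st ≡ just j → firstS st ≡ just k →
            Ssum (bin st) < Lsum (bin st) → Step st (closeCheck (addS st k))

  data Reachable : State → Set where
    start : Reachable initial
    next  : ∀ {st st'} → Reachable st → Step st st' → Reachable st'

  S : State → ℚ
  S st = Ssum (bin st)

  L : State → ℚ
  L st = Lsum (bin st)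

  lastSinBin : State → Maybe (Fin n)
  lastSinBin st = lastS (bin st)

{-# OPTIONS --safe #-}
module Submission where

-- Invariant: each s-heavy item of the open bin sits on a part with S ≤ L, since s-heavy items
-- are added only when L > S, and a removal either deletes the top s-heavy item or (after an
-- s-heavy addition pushed L above 1) leaves S < 1 - ρ < L unless the bin is closed. If t is the
-- last s-heavy item, S - L is then s t - l t plus the excess of the part below t (≤ 0) plus
-- those of the l-heavy items above t (< 0). Without s-heavy items the bin is empty or has
-- S < L, both excluded by the hypotheses.

open import Defs
open import Data.Nat using (ℕ)
open import Data.Fin using (Fin)
open import Data.Maybe using (just; nothing)
open import Data.Product using (_×_; ∃; _,_; proj₁; proj₂)
open import Data.Sum using (_⊎_; inj₁; inj₂)
open import Data.Empty using (⊥-elim)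
open import Data.List using (List; []; _∷_; foldr; map; head; allFin)
open import Data.List.Membership.Propositional using (_∈_)
open import Data.List.Membership.Propositional.Properties using (∈-allFin; ∈-map⁺; ∈-filter⁻)
open import Data.List.Relation.Unary.Any using (here; there)
open import Data.Rational using (ℚ; 0ℚ; 1ℚ; _+_; _-_; -_; _⊔_; _≤_; _<_)
open import Data.Rational.Properties
  using ( ≤-refl; ≤-reflexive; ≤-trans; <⇒≤; ≰⇒>; <-irrefl; <-asym; <-trans; <-≤-trans
        ; +-mono-<; +-monoˡ-≤; +-monoʳ-≤; +-monoˡ-<; +-identityˡ; +-identityʳ; +-inverseʳ
        ; _≤?_; _<?_; p≤p⊔q; p≤q⊔p; p≤q⇒p≤r⊔q; module ≤-Reasoning)
open import Data.Rational.Solver using (module +-*-Solver)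
open import Data.List.Properties using (filter-accept; filter-reject)
open import Relation.Nullary using (¬_; Dec; yes; no)
open import Relation.Nullary.Decidable using (decidable-stable)
open import Relation.Binary.PropositionalEquality using (_≡_; refl; sym; trans; cong; subst; module ≡-Reasoning)

open +-*-Solver using (solve; _:+_; _:-_; :-_; _:=_)

p≤q⇒p-q≤0 : ∀ {p q} → p ≤ q → p - q ≤ 0ℚ
p≤q⇒p-q≤0 {p} {q} p≤q = ≤-trans (+-monoˡ-≤ (- q) p≤q) (≤-reflexive (+-inverseʳ q))

+-cancelˡ-≤ : ∀ r {p q} → r + p ≤ r + q → p ≤ q
+-cancelˡ-≤ r {p} {q} r+p≤r+q = begin
  p                ≡⟨ sym (-r+[r+p]≡p r p) ⟩
  - r + (r + p)    ≤⟨ +-monoʳ-≤ (- r) r+p≤r+q ⟩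
  - r + (r + q)    ≡⟨ -r+[r+p]≡p r q ⟩
  q                ∎
  where
  open ≤-Reasoning
  -r+[r+p]≡p : ∀ r p → - r + (r + p) ≡ p
  -r+[r+p]≡p = solve 2 (λ r p → :- r :+ (r :+ p) := p) refl

p<q+r⇒p-q<r : ∀ {p} q {r} → p < q + r → p - q < r
p<q+r⇒p-q<r {p} q {r} p<q+r =
  subst (p - q <_) ([q+r]-q≡r q r) (+-monoˡ-< (- q) p<q+r)
  where
  [q+r]-q≡r : ∀ q r → (q + r) - q ≡ r
  [q+r]-q≡r = solve 2 (λ q r → (q :+ r) :- q := r) refl

≤-foldr-⊔ : ∀ {q} qs → q ∈ qs → q ≤ foldr _⊔_ 0ℚ qs
≤-foldr-⊔ (q ∷ qs) (here refl)  = p≤p⊔q q _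
≤-foldr-⊔ (q ∷ qs) (there q∈qs) = p≤q⇒p≤r⊔q q (≤-foldr-⊔ qs q∈qs)

module PackDisksInvariant {n : ℕ} (s l : Fin n → ℚ) where
  open PackDisks s l

  l≤ρ : ∀ i → l i ≤ ρ
  l≤ρ i = ≤-trans (p≤q⊔p (s i) (l i))
                  (≤-foldr-⊔ _ (∈-map⁺ (λ j → s j ⊔ l j) (∈-allFin i)))

  firstL-lHeavy : ∀ st {j} → firstL st ≡ just j → LHeavy j
  firstL-lHeavy st {j} eq = proj₂ (∈-filter⁻ lHeavy? {xs = unList (un st)} (head≡just⇒∈ _ eq))
    where
    head≡just⇒∈ : ∀ (xs : List (Fin n)) → head xs ≡ just j → j ∈ xs
    head≡just⇒∈ (x ∷ xs) refl = here refl

  excess : List (Fin n) → ℚ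
  excess b = Ssum b - Lsum b

  excess-∷ : ∀ x xs → excess (x ∷ xs) ≡ (s x - l x) + excess xs
  excess-∷ x xs = solve 4 (λ a b c d → (a :+ b) :- (c :+ d) := (a :- c) :+ (b :- d)) refl
                          (s x) (Ssum xs) (l x) (Lsum xs)

  data Stacked : List (Fin n) → Set where
    []  : Stacked []
    _∷_ : ∀ {x xs} → (SHeavy x → Ssum xs ≤ Lsum xs) → Stacked xs → Stacked (x ∷ xs)

  lastS-accept : ∀ {x} xs → SHeavy x → lastS (x ∷ xs) ≡ just x
  lastS-accept xs sx = cong head (filter-accept sHeavy? {xs = xs} sx)

  lastS-reject : ∀ {x} xs → ¬ SHeavy x → lastS (x ∷ xs) ≡ lastS xs
  lastS-reject xs ¬sx = cong head (filter-reject sHeavy? {xs = xs} ¬sx)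

  lastS≡just⇒excess≤ : ∀ {b t} → Stacked b → lastS b ≡ just t → excess b ≤ s t - l t
  lastS≡just⇒excess≤ {x ∷ xs} {t} (below ∷ stacked) eq with sHeavy? x
  ... | yes sx with trans (sym (lastS-accept xs sx)) eq
  ...   | refl = begin
    excess (x ∷ xs)          ≡⟨ excess-∷ x xs ⟩
    (s x - l x) + excess xs  ≤⟨ +-monoʳ-≤ (s x - l x) (p≤q⇒p-q≤0 (below sx)) ⟩
    (s x - l x) + 0ℚ         ≡⟨ +-identityʳ _ ⟩
    s x - l x                ∎
    where open ≤-Reasoning
  lastS≡just⇒excess≤ {x ∷ xs} {t} (_ ∷ stacked) eq | no ¬sx = begin
    excess (x ∷ xs)          ≡⟨ excess-∷ x xs ⟩
    (s x - l x) + excess xs  ≤⟨ +-monoˡ-≤ (excess xs) (p≤q⇒p-q≤0 (<⇒≤ (≰⇒> ¬sx))) ⟩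
    0ℚ + excess xs           ≡⟨ +-identityˡ _ ⟩
    excess xs                ≤⟨ lastS≡just⇒excess≤ stacked (trans (sym (lastS-reject xs ¬sx)) eq) ⟩
    s t - l t                ∎
    where open ≤-Reasoning

  lastS≡nothing⇒Ssum<Lsum : ∀ b → lastS b ≡ nothing → b ≡ [] ⊎ Ssum b < Lsum b
  lastS≡nothing⇒Ssum<Lsum []       _  = inj₁ refl
  lastS≡nothing⇒Ssum<Lsum (x ∷ xs) eq with sHeavy? x
  ... | yes sx with trans (sym (lastS-accept xs sx)) eq
  ...   | ()
  lastS≡nothing⇒Ssum<Lsum (x ∷ xs) eq | no ¬sx
    with lastS≡nothing⇒Ssum<Lsum xs (trans (sym (lastS-reject xs ¬sx)) eq)
  ... | inj₁ refl = inj₂ (+-monoˡ-< 0ℚ (≰⇒> ¬sx))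
  ... | inj₂ S<L  = inj₂ (+-mono-< (≰⇒> ¬sx) S<L)

  removeLast-sHeavy-stacked : ∀ {b r b′} → Stacked b →
                              removeLast sHeavy? b ≡ just (r , b′) → Stacked b′
  removeLast-sHeavy-stacked {x ∷ xs} (_ ∷ stacked) eq with sHeavy? x
  removeLast-sHeavy-stacked {x ∷ xs} (_ ∷ stacked) refl | yes _ = stacked
  ... | no ¬sx with removeLast sHeavy? xs in eq′
  removeLast-sHeavy-stacked {x ∷ xs} (_ ∷ stacked) () | no ¬sx | nothing
  removeLast-sHeavy-stacked {x ∷ xs} (_ ∷ stacked) refl | no ¬sx | just _ =
    (λ sx → ⊥-elim (¬sx sx)) ∷ removeLast-sHeavy-stacked stacked eq′

  -- The items above the removed one are s-heavy, so S ≤ L passes down to each part below them.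
  removeLast-lHeavy-stacked : ∀ {b r b′} → Stacked b →
                              removeLast lHeavy? b ≡ just (r , b′) →
                              Ssum b′ ≤ Lsum b′ → Stacked b′
  removeLast-lHeavy-stacked {x ∷ xs} (_ ∷ stacked) eq _ with lHeavy? x
  removeLast-lHeavy-stacked {x ∷ xs} (_ ∷ stacked) refl _ | yes _ = stacked
  ... | no ¬lx with removeLast lHeavy? xs in eq′
  removeLast-lHeavy-stacked {x ∷ xs} (_ ∷ stacked) () _ | no ¬lx | nothing
  removeLast-lHeavy-stacked {x ∷ xs} (_ ∷ stacked) refl S≤L | no ¬lx | just (_ , ys) =
    (λ _ → below) ∷ removeLast-lHeavy-stacked stacked eq′ below
    where
    below : Ssum ys ≤ Lsum ys
    below = +-cancelˡ-≤ (l x) (≤-trans (+-monoˡ-≤ _ (decidable-stable (sHeavy? x) ¬lx)) S≤L)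

  removeLast-Lsum : ∀ {P : Fin n → Set} (P? : ∀ i → Dec (P i)) {b r b′} →
                    removeLast P? b ≡ just (r , b′) → Lsum b ≡ l r + Lsum b′
  removeLast-Lsum P? {x ∷ xs} eq with P? x
  removeLast-Lsum P? {x ∷ xs} refl | yes _ = refl
  ... | no _ with removeLast P? xs in eq′
  removeLast-Lsum P? {x ∷ xs} () | no _ | nothing
  removeLast-Lsum P? {x ∷ xs} refl | no _ | just (y , ys) = begin
    l x + Lsum xs         ≡⟨ cong (l x +_) (removeLast-Lsum P? {xs} eq′) ⟩
    l x + (l y + Lsum ys) ≡⟨ swap (l x) (l y) (Lsum ys) ⟩
    l y + (l x + Lsum ys) ∎
    where
    open ≡-Reasoning
    swap : ∀ a b c → a + (b + c) ≡ b + (a + c)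
    swap = solve 3 (λ a b c → a :+ (b :+ c) := b :+ (a :+ c)) refl

  stacked-openBin : ∀ u → Stacked (bin (openBin u))
  stacked-openBin u with head (unList u)
  ... | nothing = []
  ... | just _  = (λ _ → ≤-refl) ∷ []

  stacked-closeCheck : ∀ st →
                       (Ssum (bin st) < 1ℚ - ρ ⊎ Lsum (bin st) < 1ℚ - ρ → Stacked (bin st)) →
                       Stacked (bin (closeCheck st))
  stacked-closeCheck st stacked with 1ℚ - ρ ≤? Ssum (bin st) | 1ℚ - ρ ≤? Lsum (bin st)
  ... | yes _ | yes _  = stacked-openBin (un st)
  ... | yes _ | no L≱  = stacked (inj₂ (≰⇒> L≱))
  ... | no S≱ | _      = stacked (inj₁ (≰⇒> S≱))

  stacked-addL : ∀ st {j} → LHeavy j → Stacked (bin st) → Stacked (bin (addL st j))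
  stacked-addL st {j} lj stacked with 1ℚ <? Ssum (j ∷ bin st)
  ... | no _ = (λ sj → ⊥-elim (lj sj)) ∷ stacked
  ... | yes _ with removeLast sHeavy? (j ∷ bin st) in eq
  ...   | nothing = (λ sj → ⊥-elim (lj sj)) ∷ stacked
  ...   | just _  = removeLast-sHeavy-stacked ((λ sj → ⊥-elim (lj sj)) ∷ stacked) eq

  -- If an l-heavy item r had to be removed, the remaining l-sum exceeds 1 - l r ≥ 1 - ρ,
  -- so the bin can stay open only because its s-sum is below 1 - ρ < L.
  stacked-addS : ∀ st k → Ssum (bin st) < Lsum (bin st) → Stacked (bin st) →
                 Ssum (bin (addS st k)) < 1ℚ - ρ ⊎ Lsum (bin (addS st k)) < 1ℚ - ρ →
                 Stacked (bin (addS st k))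
  stacked-addS st k S<L stacked unfilled with 1ℚ <? Lsum (k ∷ bin st)
  ... | no _ = (λ _ → <⇒≤ S<L) ∷ stacked
  ... | yes L>1 with removeLast lHeavy? (k ∷ bin st) in eq
  ...   | nothing = (λ _ → <⇒≤ S<L) ∷ stacked
  ...   | just (r , b′) = kept-open⇒stacked unfilled
    where
    L′>1-ρ : 1ℚ - ρ < Lsum b′
    L′>1-ρ = p<q+r⇒p-q<r ρ (<-≤-trans (subst (1ℚ <_) (removeLast-Lsum lHeavy? eq) L>1)
                                        (+-monoˡ-≤ (Lsum b′) (l≤ρ r)))
    kept-open⇒stacked : Ssum b′ < 1ℚ - ρ ⊎ Lsum b′ < 1ℚ - ρ → Stacked b′
    kept-open⇒stacked (inj₁ S′<1-ρ) =
      removeLast-lHeavy-stacked ((λ _ → <⇒≤ S<L) ∷ stacked) eq (<⇒≤ (<-trans S′<1-ρ L′>1-ρ))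
    kept-open⇒stacked (inj₂ L′<1-ρ) = ⊥-elim (<-asym L′<1-ρ L′>1-ρ)

  stacked-reachable : ∀ {st} → Reachable st → Stacked (bin st)
  stacked-reachable start = stacked-openBin _
  stacked-reachable (next {st} reach (stepL firstL≡j _ _)) =
    stacked-closeCheck _ λ _ →
      stacked-addL st (firstL-lHeavy st firstL≡j) (stacked-reachable reach)
  stacked-reachable (next {st} reach (stepS {k = k} _ _ S<L)) =
    stacked-closeCheck _ (stacked-addS st k S<L (stacked-reachable reach))

  excess≤lastSinBin : ∀ {st lp} → Reachable st → s lp ≤ 1ℚ → L st ≤ S st → 1ℚ < S st + s lp →
                      ∃ λ t → lastSinBin st ≡ just t × S st - L st ≤ s t - l t
  excess≤lastSinBin {st} {lp} reach slp≤1 L≤S S+slp>1 with lastS (bin st) in lastS≡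
  ... | just t  = t , refl , lastS≡just⇒excess≤ (stacked-reachable reach) lastS≡
  ... | nothing with lastS≡nothing⇒Ssum<Lsum (bin st) lastS≡
  ...   | inj₂ S<L   = ⊥-elim (<-irrefl refl (<-≤-trans S<L L≤S))
  ...   | inj₁ empty = ⊥-elim (<-irrefl refl (<-≤-trans S+slp>1 S+slp≤1))
    where
    S+slp≤1 : Ssum (bin st) + s lp ≤ 1ℚ
    S+slp≤1 rewrite empty = ≤-trans (≤-reflexive (+-identityˡ (s lp))) slp≤1

lemma1 : (n : ℕ) (s l : Fin n → ℚ) →
    (∀ i → (0ℚ ≤ s i × s i ≤ 1ℚ) × (0ℚ ≤ l i × l i ≤ 1ℚ)) →
    ∀ st → PackDisks.Reachable s l st →
    ∀ lp → PackDisks.firstL s l st ≡ just lp →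
    PackDisks.L s l st ≤ PackDisks.S s l st →
    1ℚ < PackDisks.S s l st + s lp →
    ∃ λ t → PackDisks.lastSinBin s l st ≡ just t ×
    PackDisks.S s l st - PackDisks.L s l st ≤ s t - l t
lemma1 n s l bounds st reach lp _ =
  PackDisksInvariant.excess≤lastSinBin s l reach (proj₂ (proj₁ (bounds lp)))
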